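{- Let $q\ge2$, let $x$ be a $q$-regular sequence with linear representation $(u,A,w)$, $A=(A_r)_{0\le r<q}$ a family of $D\times D$ complex matrices, associated right vector-valued sequence $v$, and let $k\ge1$. Set $C\coloneqq\sum_{0\le s<q}A_s$. Then $\Sigma^kx$ is $q$-regular with a linear representation $(\widetilde u,\widetilde A,\widetilde w)$, where $\widetilde u$ is a row vector, $\widetilde w$ is a column vector, and for each $0\le r<q$ the matrix $\widetilde A_r$ is block upper triangular with diagonal blocks $q^{k-1}C, q^{k-2}C,\dots,qC,C,A_r$ (in this order); the associated right vector-valued sequence is $(\Sigma^kv,\Sigma^{k-1}v,\dots,\Sigma v,v)^\top$.
   Context: A sequence $x\in\mathbb{C}^{\mathbb{N}_0}$ is $q$-regular if there are $D\ge0$, a family $A=(A_r)_{0\le r<q}$ of $D\times D$ complex matrices, $u\in\mathbb{C}^{1\times D}$ and a sequence $v\colon\mathbb{N}_0\to\mathbb{C}^{D\times1}$ with $x(n)=u\,v(n)$ for all $n\ge0$ and $v(qn+r)=A_rv(n)$ for all $n\ge0$, $0\le r<q$; $(u,A,v(0))$ is then a linear representation of $x$ and $v$ its associated right vector-valued sequence. For a (vector-valued) sequence $y$, $\Sigma y(N)\coloneqq\sum_{0\le n<N}y(n)$, and $\Sigma^k$ is its $k$-fold iterate. -}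

module Defs where


open import Algebra.Bundles using (CommutativeRing)
open import Data.Nat as ℕ using (ℕ; zero; suc; _∸_)
open import Data.Fin as Fin using (Fin; zero; suc; toℕ; remQuot; combine)
open import Data.Product using (_×_; _,_; proj₁; proj₂)
open import Relation.Nullary using (yes; no)

-- Everything is parametrised by a commutative ring R (standing in for ℂ).
module Reg {c ℓ} (R : CommutativeRing c ℓ) where
  open CommutativeRing R using (Carrier; _≈_; _+_; _*_; 0#; 1#)

  Vector : ℕ → Set c
  Vector n = Fin n → Carrier

  Matrix : ℕ → ℕ → Set c
  Matrix m n = Fin m → Fin n → Carrier

  sumF : ∀ n → (Fin n → Carrier) → Carrier
  sumF zero    f = 0#
  sumF (suc n) f = f zero + sumF n (λ i → f (suc i))

  _·_ : ∀ {n} → Vector n → Vector n → Carrier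
  _·_ {n} u w = sumF n (λ i → u i * w i)

  _⊙_ : ∀ {m n} → Matrix m n → Vector n → Vector m
  _⊙_ {n = n} M w i = sumF n (λ j → M i j * w j)

  ι : ℕ → Carrier
  ι zero    = 0#
  ι (suc n) = 1# + ι n

  _•_ : ∀ {m n} → Carrier → Matrix m n → Matrix m n
  (a • M) i j = a * M i j

  Σ : (ℕ → Carrier) → ℕ → Carrier
  Σ y zero    = 0#
  Σ y (suc N) = Σ y N + y N

  ΣV : ∀ {D} → (ℕ → Vector D) → ℕ → Vector D
  ΣV v N i = Σ (λ n → v n i) N

  Σ^ : ℕ → (ℕ → Carrier) → ℕ → Carrier
  Σ^ zero    y = y
  Σ^ (suc k) y = Σ (Σ^ k y)

  ΣV^ : ∀ {D} → ℕ → (ℕ → Vector D) → ℕ → Vector D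
  ΣV^ zero    v = v
  ΣV^ (suc k) v = ΣV (ΣV^ k v)

  -- (u, A, v(0)) is a linear representation of x with associated right
  -- vector-valued sequence v:  x(n) = u v(n),  v(qn+r) = A_r v(n).
  IsLinRep : (q D : ℕ) → (ℕ → Carrier) → Vector D → (Fin q → Matrix D D)
           → (ℕ → Vector D) → Set ℓ
  IsLinRep q D x u A v =
    (∀ n → x n ≈ u · v n) ×
    (∀ n (r : Fin q) (i : Fin D) → v (q ℕ.* n ℕ.+ toℕ r) i ≈ (A r ⊙ v n) i)

  Csum : ∀ {q D} → (Fin q → Matrix D D) → Matrix D D
  Csum {q} A i j = sumF q (λ s → A s i j)

  -- The stacked sequence (Σ^k v, Σ^{k-1} v, …, Σ v, v)^T of dimension (k+1)·D;
  -- block j (0 ≤ j ≤ k) is Σ^{k-j} v; entry (j,i) sits at index combine j i.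
  stack : ∀ {D} (k : ℕ) → (ℕ → Vector D) → ℕ → Vector (suc k ℕ.* D)
  stack {D} k v N idx with remQuot {suc k} D idx
  ... | j , i = ΣV^ (k ∸ toℕ j) v N i

  diagBlock : ∀ {D} (q k : ℕ) → (Fin q → Matrix D D) → Fin q → Fin (suc k) → Matrix D D
  diagBlock q k A r j with toℕ j ℕ.≟ k
  ... | yes _ = A r
  ... | no  _ = ι (q ℕ.^ (k ∸ suc (toℕ j))) • Csum A

  BlockUpperTri : ∀ {D} (k : ℕ) → Matrix (suc k ℕ.* D) (suc k ℕ.* D)
                → (Fin (suc k) → Matrix D D) → Set ℓ
  BlockUpperTri {D} k M B =
    (∀ (j j′ : Fin (suc k)) (i i′ : Fin D) → toℕ j′ ℕ.< toℕ j →
       M (combine j i) (combine j′ i′) ≈ 0#) ×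
    (∀ (j : Fin (suc k)) (i i′ : Fin D) → M (combine j i) (combine j i′) ≈ B j i i′)

-- Write N = q n + r with r < q.  The prefix sum of a sequence y up to N
-- splits into n complete digit blocks, the p-th one summing y (q p + s)
-- over all s < q, and the partial block s < r.  Applied to y = Σ^m v,
-- this gives by induction on m an expansion
--   Σ^m v (q n + r) = Σ_{t ≤ m} coeff m r t · Σ^t v (n)
-- in which the complete blocks contribute (Σ_{s<q} coeff m s t) Σ^{t+1} v (n)
-- and the partial block (Σ_{s<r} coeff m s t) Σ^t v (n).  Hence coeff m r t
-- vanishes for t > m, coeff 0 r 0 = A_r and
-- coeff (m+1) r (m+1) = Σ_{s<q} coeff m s m = q^m C.  Stacking the blocks
-- coeff (k-j) r (k-j′) gives the block upper triangular matrices Ã_r.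

{-# OPTIONS --safe #-}
module Submission where

open import Defs
open import Algebra.Bundles using (CommutativeRing)
open import Data.Nat using (ℕ; suc; _*_; _≤_)
open import Data.Fin using (Fin)
open import Data.Product using (Σ-syntax; _×_)

open import Algebra.Properties.CommutativeSemigroup using (interchange)
import Algebra.Properties.Semiring.Mult as SemiringMult
open import Data.Nat using (zero; _<_; _∸_; _^_; s≤s; _<?_; _≟_)
import Data.Nat as ℕ
import Data.Nat.Properties as ℕₚ
open import Data.Fin using (zero; suc; toℕ; fromℕ<; combine; quotient; remainder; _↑ˡ_; _↑ʳ_)
import Data.Fin.Properties as Finₚ
open import Data.Product using (_,_; proj₁; proj₂; uncurry)
open import Function using (_∘_)
import Relation.Binary.PropositionalEquality as ≡
open ≡ using (_≡_)
import Relation.Binary.Reasoning.Setoid as SetoidReasoning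
open import Relation.Nullary using (yes; no)
open import Relation.Nullary.Negation using (contradiction)

module RegularSummation {c ℓ} (R : CommutativeRing c ℓ) where
  open CommutativeRing R hiding (zero) renaming (_*_ to _*ᴿ_)
  open Reg R
  open SetoidReasoning setoid
  open SemiringMult semiring using (×1-homo-*) renaming (_×_ to _×ᴿ_)

  +-interchange : ∀ a b c d → (a + b) + (c + d) ≈ (a + c) + (b + d)
  +-interchange = interchange +-commutativeSemigroup

  sumF-cong : ∀ n {f g : Fin n → Carrier} → (∀ i → f i ≈ g i) → sumF n f ≈ sumF n g
  sumF-cong zero    f≈g = refl
  sumF-cong (suc n) f≈g = +-cong (f≈g zero) (sumF-cong n (f≈g ∘ suc))

  sumF-zero : ∀ n {f : Fin n → Carrier} → (∀ i → f i ≈ 0#) → sumF n f ≈ 0#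
  sumF-zero zero    f≈0 = refl
  sumF-zero (suc n) f≈0 =
    trans (+-cong (f≈0 zero) (sumF-zero n (f≈0 ∘ suc))) (+-identityʳ 0#)

  sumF-distrib-+ : ∀ n (f g : Fin n → Carrier) →
    sumF n (λ i → f i + g i) ≈ sumF n f + sumF n g
  sumF-distrib-+ zero    f g = sym (+-identityʳ 0#)
  sumF-distrib-+ (suc n) f g =
    trans (+-congˡ (sumF-distrib-+ n (f ∘ suc) (g ∘ suc))) (+-interchange _ _ _ _)

  sumF-splitAt : ∀ m n (f : Fin (m ℕ.+ n) → Carrier) →
    sumF (m ℕ.+ n) f ≈ sumF m (λ i → f (i ↑ˡ n)) + sumF n (λ i → f (m ↑ʳ i))
  sumF-splitAt zero    n f = sym (+-identityˡ _)
  sumF-splitAt (suc m) n f =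
    trans (+-congˡ (sumF-splitAt m n (f ∘ suc))) (sym (+-assoc _ _ _))

  sumF-combine : ∀ m n (f : Fin (m * n) → Carrier) →
    sumF (m * n) f ≈ sumF m (λ j → sumF n (λ i → f (combine j i)))
  sumF-combine zero    n f = refl
  sumF-combine (suc m) n f =
    trans (sumF-splitAt n (m * n) f) (+-congˡ (sumF-combine m n (λ b → f (n ↑ʳ b))))

  Σ-cong< : ∀ N {f g : ℕ → Carrier} → (∀ n → n < N → f n ≈ g n) → Σ f N ≈ Σ g N
  Σ-cong< zero    f≈g = refl
  Σ-cong< (suc N) f≈g =
    +-cong (Σ-cong< N (λ n n<N → f≈g n (ℕₚ.m<n⇒m<1+n n<N))) (f≈g N (ℕₚ.n<1+n N))

  Σ-cong : ∀ N {f g : ℕ → Carrier} → (∀ n → f n ≈ g n) → Σ f N ≈ Σ g N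
  Σ-cong N f≈g = Σ-cong< N (λ n _ → f≈g n)

  Σ-zero : ∀ N {f : ℕ → Carrier} → (∀ n → f n ≈ 0#) → Σ f N ≈ 0#
  Σ-zero zero    f≈0 = refl
  Σ-zero (suc N) f≈0 = trans (+-cong (Σ-zero N f≈0) (f≈0 N)) (+-identityʳ 0#)

  Σ-distrib-+ : ∀ N (f g : ℕ → Carrier) → Σ (λ n → f n + g n) N ≈ Σ f N + Σ g N
  Σ-distrib-+ zero    f g = sym (+-identityʳ 0#)
  Σ-distrib-+ (suc N) f g = trans (+-congʳ (Σ-distrib-+ N f g)) (+-interchange _ _ _ _)

  Σ-distribˡ-* : ∀ N a (f : ℕ → Carrier) → a *ᴿ Σ f N ≈ Σ (λ n → a *ᴿ f n) N
  Σ-distribˡ-* zero    a f = zeroʳ a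
  Σ-distribˡ-* (suc N) a f = trans (distribˡ a _ _) (+-congʳ (Σ-distribˡ-* N a f))

  Σ-distribʳ-* : ∀ N a (f : ℕ → Carrier) → Σ f N *ᴿ a ≈ Σ (λ n → f n *ᴿ a) N
  Σ-distribʳ-* zero    a f = zeroˡ a
  Σ-distribʳ-* (suc N) a f = trans (distribʳ a _ _) (+-congʳ (Σ-distribʳ-* N a f))

  Σ-comm : ∀ M N (f : ℕ → ℕ → Carrier) →
    Σ (λ m → Σ (f m) N) M ≈ Σ (λ n → Σ (λ m → f m n) M) N
  Σ-comm zero    N f = sym (Σ-zero N (λ _ → refl))
  Σ-comm (suc M) N f = trans (+-congʳ (Σ-comm M N f)) (sym (Σ-distrib-+ N _ _))

  Σ-sumF-comm : ∀ N n (f : ℕ → Fin n → Carrier) →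
    Σ (λ m → sumF n (f m)) N ≈ sumF n (λ i → Σ (λ m → f m i) N)
  Σ-sumF-comm zero    n f = sym (sumF-zero n (λ _ → refl))
  Σ-sumF-comm (suc N) n f = trans (+-congʳ (Σ-sumF-comm N n f)) (sym (sumF-distrib-+ n _ _))

  Σ-shift : ∀ N (f : ℕ → Carrier) → Σ f (suc N) ≈ f 0 + Σ (f ∘ suc) N
  Σ-shift zero    f = trans (+-identityˡ _) (sym (+-identityʳ _))
  Σ-shift (suc N) f = trans (+-congʳ (Σ-shift N f)) (+-assoc _ _ _)

  Σ-shift-+ : ∀ N (f g : ℕ → Carrier) →
    Σ f (suc N) + Σ g N ≈ f 0 + Σ (λ n → f (suc n) + g n) N
  Σ-shift-+ N f g = begin
    Σ f (suc N) + Σ g N             ≈⟨ +-congʳ (Σ-shift N f) ⟩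
    (f 0 + Σ (f ∘ suc) N) + Σ g N   ≈⟨ +-assoc _ _ _ ⟩
    f 0 + (Σ (f ∘ suc) N + Σ g N)   ≈⟨ +-congˡ (Σ-distrib-+ N _ _) ⟨
    f 0 + Σ (λ n → f (suc n) + g n) N ∎

  Σ-split : ∀ M N (f : ℕ → Carrier) → Σ f (M ℕ.+ N) ≈ Σ f M + Σ (λ n → f (M ℕ.+ n)) N
  Σ-split M zero    f rewrite ℕₚ.+-identityʳ M = sym (+-identityʳ _)
  Σ-split M (suc N) f rewrite ℕₚ.+-suc M N = trans (+-congʳ (Σ-split M N f)) (+-assoc _ _ _)

  Σ-blocks : ∀ q N (f : ℕ → Carrier) → Σ f (q * N) ≈ Σ (λ n → Σ (λ s → f (q * n ℕ.+ s)) q) N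
  Σ-blocks q zero    f rewrite ℕₚ.*-zeroʳ q = refl
  Σ-blocks q (suc N) f rewrite ℕₚ.*-suc q N | ℕₚ.+-comm q (q * N) =
    trans (Σ-split (q * N) q f) (+-congʳ (Σ-blocks q N f))

  Σ-digits : ∀ q n r (f : ℕ → Carrier) →
    Σ f (q * n ℕ.+ r) ≈ Σ (λ p → Σ (λ s → f (q * p ℕ.+ s)) q) n + Σ (λ s → f (q * n ℕ.+ s)) r
  Σ-digits q n r f = trans (Σ-split (q * n) r f) (+-congʳ (Σ-blocks q n f))

  Σ-reverse : ∀ N (f : ℕ → Carrier) → sumF (suc N) (λ j → f (N ∸ toℕ j)) ≈ Σ f (suc N)
  Σ-reverse zero    f = +-comm _ _
  Σ-reverse (suc N) f = trans (+-congˡ (Σ-reverse N f)) (+-comm _ _)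

  Σ-toℕ : ∀ N (f : ℕ → Carrier) → Σ f N ≈ sumF N (f ∘ toℕ)
  Σ-toℕ zero    f = refl
  Σ-toℕ (suc N) f = trans (Σ-shift N f) (+-congˡ (Σ-toℕ N (f ∘ suc)))

  Σ-const : ∀ N a → Σ (λ _ → a) N ≈ ι N *ᴿ a
  Σ-const zero    a = sym (zeroˡ a)
  Σ-const (suc N) a = begin
    Σ (λ _ → a) N + a    ≈⟨ +-cong (Σ-const N a) (sym (*-identityˡ a)) ⟩
    ι N *ᴿ a + 1# *ᴿ a   ≈⟨ +-comm _ _ ⟩
    1# *ᴿ a + ι N *ᴿ a   ≈⟨ distribʳ a 1# (ι N) ⟨
    ι (suc N) *ᴿ a       ∎

  ι≈×1 : ∀ n → ι n ≈ n ×ᴿ 1#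
  ι≈×1 zero    = refl
  ι≈×1 (suc n) = +-congˡ (ι≈×1 n)

  ι-homo-* : ∀ m n → ι (m * n) ≈ ι m *ᴿ ι n
  ι-homo-* m n =
    trans (ι≈×1 (m * n)) (trans (×1-homo-* m n) (sym (*-cong (ι≈×1 m) (ι≈×1 n))))

  -- (M ⊙ w) i is definitionally M i · w, so the lemmas on _·_ apply to _⊙_.

  ·-congʳ : ∀ {n} {u u′ : Vector n} (w : Vector n) → (∀ j → u j ≈ u′ j) → u · w ≈ u′ · w
  ·-congʳ {n} w u≈u′ = sumF-cong n (λ j → *-congʳ (u≈u′ j))

  ·-zeroˡ : ∀ {n} {u : Vector n} (w : Vector n) → (∀ j → u j ≈ 0#) → u · w ≈ 0#
  ·-zeroˡ {n} w u≈0 = sumF-zero n (λ j → trans (*-congʳ (u≈0 j)) (zeroˡ (w j)))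

  ·-distribʳ-+ : ∀ {n} (u u′ w : Vector n) → (λ j → u j + u′ j) · w ≈ u · w + u′ · w
  ·-distribʳ-+ {n} u u′ w =
    trans (sumF-cong n (λ j → distribʳ (w j) (u j) (u′ j))) (sumF-distrib-+ n _ _)

  Σ-·ʳ : ∀ N {n} (u : Vector n) (w : ℕ → Vector n) → Σ (λ m → u · w m) N ≈ u · ΣV w N
  Σ-·ʳ N {n} u w =
    trans (Σ-sumF-comm N n _) (sumF-cong n (λ j → sym (Σ-distribˡ-* N (u j) _)))

  Σ-·ˡ : ∀ N {n} (u : ℕ → Vector n) (w : Vector n) → Σ (λ m → u m · w) N ≈ ΣV u N · w
  Σ-·ˡ N {n} u w =
    trans (Σ-sumF-comm N n _) (sumF-cong n (λ j → sym (Σ-distribʳ-* N (w j) _)))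

  Σ^-· : ∀ {D} {x : ℕ → Carrier} (u : Vector D) (v : ℕ → Vector D) →
    (∀ n → x n ≈ u · v n) → ∀ k n → Σ^ k x n ≈ u · ΣV^ k v n
  Σ^-· u v x≈u·v zero    n = x≈u·v n
  Σ^-· u v x≈u·v (suc k) n = trans (Σ-cong n (Σ^-· u v x≈u·v k)) (Σ-·ʳ n u (ΣV^ k v))

  0ᴹ : ∀ {m n} → Matrix m n
  0ᴹ _ _ = 0#

  _+ᴹ_ : ∀ {m n} → Matrix m n → Matrix m n → Matrix m n
  (M +ᴹ M′) a b = M a b + M′ a b

  ΣM : ∀ {m n} → (ℕ → Matrix m n) → ℕ → Matrix m n
  ΣM M N a = ΣV (λ s → M s a) N

  Σ-⊙-comm : ∀ {m n} N T (M : ℕ → Matrix m n) (y : ℕ → ℕ → Vector n) i →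
    Σ (λ p → Σ (λ t → (M t ⊙ y t p) i) T) N ≈ Σ (λ t → (M t ⊙ ΣV (y t) N) i) T
  Σ-⊙-comm N T M y i = trans (Σ-comm N T _) (Σ-cong T (λ t → Σ-·ʳ N (M t i) (y t)))

  Σ-⊙-collect : ∀ {m n} r T (M : ℕ → ℕ → Matrix m n) (y : ℕ → Vector n) i
    {f : ℕ → Carrier} → (∀ s → s < r → f s ≈ Σ (λ t → (M s t ⊙ y t) i) T) →
    Σ f r ≈ Σ (λ t → (ΣM (λ s → M s t) r ⊙ y t) i) T
  Σ-⊙-collect r T M y i {f} f≈ = begin
    Σ f r                                       ≈⟨ Σ-cong< r f≈ ⟩
    Σ (λ s → Σ (λ t → (M s t ⊙ y t) i) T) r    ≈⟨ Σ-comm r T _ ⟩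
    Σ (λ t → Σ (λ s → (M s t ⊙ y t) i) r) T    ≈⟨ Σ-cong T (λ t → Σ-·ˡ r (λ s → M s t i) (y t)) ⟩
    Σ (λ t → (ΣM (λ s → M s t) r ⊙ y t) i) T   ∎

  blockVector : ∀ {K D} → (Fin K → Vector D) → Vector (K * D)
  blockVector {K} {D} U a = U (quotient D a) (remainder {K} D a)

  blockVector-combine : ∀ {K D} (U : Fin K → Vector D) j i → blockVector U (combine j i) ≡ U j i
  blockVector-combine U j i = ≡.cong (uncurry U) (Finₚ.remQuot-combine j i)

  ·-blockVector : ∀ {K D} (U W : Fin K → Vector D) →
    blockVector U · blockVector W ≈ sumF K (λ j → U j · W j)
  ·-blockVector {K} {D} U W = trans (sumF-combine K D _) (sumF-cong K (λ j → sumF-cong D (λ i →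
    *-cong (reflexive (blockVector-combine U j i)) (reflexive (blockVector-combine W j i)))))

  blockMatrix : ∀ {K D} → (Fin K → Fin K → Matrix D D) → Matrix (K * D) (K * D)
  blockMatrix {K} {D} B a = blockVector (λ j′ → B (quotient D a) j′ (remainder {K} D a))

  blockMatrix-combine : ∀ {K D} (B : Fin K → Fin K → Matrix D D) j j′ i i′ →
    blockMatrix B (combine j i) (combine j′ i′) ≡ B j j′ i i′
  blockMatrix-combine B j j′ i i′ =
    ≡.cong₂ (λ p p′ → B (proj₁ p) (proj₁ p′) (proj₂ p) (proj₂ p′))
            (Finₚ.remQuot-combine j i) (Finₚ.remQuot-combine j′ i′)

  module Coefficients {q D : ℕ} (A : Fin q → Matrix D D) where

    -- Digits are indexed by ℕ so that partial digit sums Σ_{s<r} can use Σ.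
    Aℕ : ℕ → Matrix D D
    Aℕ s with s <? q
    ... | yes s<q = A (fromℕ< s<q)
    ... | no  _   = 0ᴹ

    Aℕ-toℕ : ∀ r a b → Aℕ (toℕ r) a b ≈ A r a b
    Aℕ-toℕ r a b with toℕ r <? q
    ... | yes r<q = reflexive (≡.cong (λ s → A s a b) (Finₚ.fromℕ<-toℕ r r<q))
    ... | no  r≮q = contradiction (Finₚ.toℕ<n r) r≮q

    coeff : ℕ → ℕ → ℕ → Matrix D D
    coeff zero    r zero    = Aℕ r
    coeff zero    r (suc t) = 0ᴹ
    coeff (suc m) r zero    = ΣM (λ s → coeff m s zero) r
    coeff (suc m) r (suc t) = ΣM (λ s → coeff m s (suc t)) r +ᴹ ΣM (λ s → coeff m s t) q

    coeff-vanishes : ∀ m r t → m < t → ∀ a b → coeff m r t a b ≈ 0#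
    coeff-vanishes zero    r (suc t) _         a b = refl
    coeff-vanishes (suc m) r (suc t) (s≤s m<t) a b =
      trans (+-cong (Σ-zero r (λ s → coeff-vanishes m s (suc t) (ℕₚ.m<n⇒m<1+n m<t) a b))
                    (Σ-zero q (λ s → coeff-vanishes m s t m<t a b)))
            (+-identityʳ 0#)

    coeff-diag-suc : ∀ m r a b → coeff (suc m) r (suc m) a b ≈ Σ (λ s → coeff m s m a b) q
    coeff-diag-suc m r a b =
      trans (+-congʳ (Σ-zero r (λ s → coeff-vanishes m s (suc m) (ℕₚ.n<1+n m) a b)))
            (+-identityˡ _)

    Σ-coeff-diag : ∀ m a b → Σ (λ s → coeff m s m a b) q ≈ ι (q ^ m) *ᴿ Csum A a b
    Σ-coeff-diag zero a b = begin
      Σ (λ s → Aℕ s a b) q             ≈⟨ Σ-toℕ q _ ⟩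
      sumF q (λ s → Aℕ (toℕ s) a b)    ≈⟨ sumF-cong q (λ s → Aℕ-toℕ s a b) ⟩
      Csum A a b                       ≈⟨ *-identityˡ _ ⟨
      1# *ᴿ Csum A a b                 ≈⟨ *-congʳ (+-identityʳ 1#) ⟨
      ι 1 *ᴿ Csum A a b                ∎
    Σ-coeff-diag (suc m) a b = begin
      Σ (λ s → coeff (suc m) s (suc m) a b) q
        ≈⟨ Σ-cong q (λ s → trans (coeff-diag-suc m s a b) (Σ-coeff-diag m a b)) ⟩
      Σ (λ _ → ι (q ^ m) *ᴿ Csum A a b) q
        ≈⟨ Σ-const q _ ⟩
      ι q *ᴿ (ι (q ^ m) *ᴿ Csum A a b)
        ≈⟨ *-assoc _ _ _ ⟨
      (ι q *ᴿ ι (q ^ m)) *ᴿ Csum A a b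
        ≈⟨ *-congʳ (ι-homo-* q (q ^ m)) ⟨
      ι (q ^ suc m) *ᴿ Csum A a b
        ∎

    coeff-diag : ∀ m r a b → coeff (suc m) r (suc m) a b ≈ (ι (q ^ m) • Csum A) a b
    coeff-diag m r a b = trans (coeff-diag-suc m r a b) (Σ-coeff-diag m a b)

    coeff-diagBlock : ∀ k r (j : Fin (suc k)) a b →
      coeff (k ∸ toℕ j) (toℕ r) (k ∸ toℕ j) a b ≈ diagBlock q k A r j a b
    coeff-diagBlock k r j a b with toℕ j ≟ k
    ... | yes j≡k rewrite j≡k | ℕₚ.n∸n≡0 k = Aℕ-toℕ r a b
    ... | no  j≢k rewrite ℕₚ.+-∸-assoc 1 (ℕₚ.≤∧≢⇒< (Finₚ.toℕ≤pred[n] j) j≢k) =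
      coeff-diag (k ∸ suc (toℕ j)) (toℕ r) a b

    Σ-coeff-suc : ∀ m r T (y : ℕ → Vector D) i →
      Σ (λ t → (coeff (suc m) r t ⊙ y t) i) (suc T) ≈
      Σ (λ t → (ΣM (λ s → coeff m s t) r ⊙ y t) i) (suc T) +
      Σ (λ t → (ΣM (λ s → coeff m s t) q ⊙ y (suc t)) i) T
    Σ-coeff-suc m r T y i = begin
      Σ (λ t → (coeff (suc m) r t ⊙ y t) i) (suc T)
        ≈⟨ Σ-shift T _ ⟩
      (P 0 ⊙ y 0) i + Σ (λ t → ((P (suc t) +ᴹ C t) ⊙ y (suc t)) i) T
        ≈⟨ +-congˡ (Σ-cong T (λ t → ·-distribʳ-+ (P (suc t) i) (C t i) (y (suc t)))) ⟩
      (P 0 ⊙ y 0) i + Σ (λ t → (P (suc t) ⊙ y (suc t)) i + (C t ⊙ y (suc t)) i) T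
        ≈⟨ Σ-shift-+ T _ _ ⟨
      Σ (λ t → (P t ⊙ y t) i) (suc T) + Σ (λ t → (C t ⊙ y (suc t)) i) T
        ∎
      where
      P C : ℕ → Matrix D D
      P t = ΣM (λ s → coeff m s t) r
      C t = ΣM (λ s → coeff m s t) q

    module Expansion (v : ℕ → Vector D)
      (v-rec : ∀ n r i → v (q * n ℕ.+ toℕ r) i ≈ (A r ⊙ v n) i) where

      v-recℕ : ∀ n s → s < q → ∀ i → v (q * n ℕ.+ s) i ≈ (Aℕ s ⊙ v n) i
      v-recℕ n s s<q i =
        ≡.subst (λ s → v (q * n ℕ.+ s) i ≈ (Aℕ s ⊙ v n) i) (Finₚ.toℕ-fromℕ< s<q)
          (trans (v-rec n r i) (sym (·-congʳ (v n) (Aℕ-toℕ r i))))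
        where
        r : Fin q
        r = fromℕ< s<q

      -- Allowing any number T > m of terms lets the induction step expand the complete
      -- and the partial digit blocks to T and suc T terms without discarding zero terms.
      ΣV^-expansion : ∀ m T → m < T → ∀ n r → r < q → ∀ i →
        ΣV^ m v (q * n ℕ.+ r) i ≈ Σ (λ t → (coeff m r t ⊙ ΣV^ t v n) i) T
      ΣV^-expansion _ zero ()
      ΣV^-expansion zero (suc T) _ n r r<q i = begin
        v (q * n ℕ.+ r) i
          ≈⟨ v-recℕ n r r<q i ⟩
        (Aℕ r ⊙ v n) i
          ≈⟨ +-identityʳ _ ⟨
        (Aℕ r ⊙ v n) i + 0#
          ≈⟨ +-congˡ (Σ-zero T (λ t → ·-zeroˡ (ΣV^ (suc t) v n) (λ _ → refl))) ⟨
        (Aℕ r ⊙ v n) i + Σ (λ t → (0ᴹ ⊙ ΣV^ (suc t) v n) i) T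
          ≈⟨ Σ-shift T _ ⟨
        Σ (λ t → (coeff zero r t ⊙ ΣV^ t v n) i) (suc T)
          ∎
      ΣV^-expansion (suc m) (suc T) (s≤s m<T) n r r<q i = begin
        Σ (λ N → ΣV^ m v N i) (q * n ℕ.+ r)
          ≈⟨ Σ-digits q n r _ ⟩
        Σ (λ p → Σ (λ s → ΣV^ m v (q * p ℕ.+ s) i) q) n + Σ (λ s → ΣV^ m v (q * n ℕ.+ s) i) r
          ≈⟨ +-cong (Σ-cong n (λ p → digitBlock T m<T p ℕₚ.≤-refl))
                    (digitBlock (suc T) (ℕₚ.m<n⇒m<1+n m<T) n (ℕₚ.<⇒≤ r<q)) ⟩
        Σ (λ p → Σ (λ t → (C t ⊙ ΣV^ t v p) i) T) n + Σ (λ t → (P t ⊙ ΣV^ t v n) i) (suc T)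
          ≈⟨ +-congʳ (Σ-⊙-comm n T C (λ t → ΣV^ t v) i) ⟩
        Σ (λ t → (C t ⊙ ΣV^ (suc t) v n) i) T + Σ (λ t → (P t ⊙ ΣV^ t v n) i) (suc T)
          ≈⟨ +-comm _ _ ⟩
        Σ (λ t → (P t ⊙ ΣV^ t v n) i) (suc T) + Σ (λ t → (C t ⊙ ΣV^ (suc t) v n) i) T
          ≈⟨ Σ-coeff-suc m r T (λ t → ΣV^ t v n) i ⟨
        Σ (λ t → (coeff (suc m) r t ⊙ ΣV^ t v n) i) (suc T)
          ∎
        where
        P C : ℕ → Matrix D D
        P t = ΣM (λ s → coeff m s t) r
        C t = ΣM (λ s → coeff m s t) q
        digitBlock : ∀ T′ → m < T′ → ∀ p {r′} → r′ ≤ q →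
          Σ (λ s → ΣV^ m v (q * p ℕ.+ s) i) r′ ≈
          Σ (λ t → (ΣM (λ s → coeff m s t) r′ ⊙ ΣV^ t v p) i) T′
        digitBlock T′ m<T′ p {r′} r′≤q =
          Σ-⊙-collect r′ T′ (coeff m) (λ t → ΣV^ t v p) i (λ s s<r′ →
            ΣV^-expansion m T′ m<T′ p s (ℕₚ.<-≤-trans s<r′ r′≤q) i)

  module SummatoryRepresentation {q D : ℕ} (x : ℕ → Carrier) (u : Vector D)
    (A : Fin q → Matrix D D) (v : ℕ → Vector D) (rep : IsLinRep q D x u A v) (k : ℕ) where
    open Coefficients A
    open Expansion v (proj₂ rep)

    topBlock : Fin (suc k) → Vector D
    topBlock zero    = u
    topBlock (suc _) = λ _ → 0#

    stackBlock : ℕ → Fin (suc k) → Vector D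
    stackBlock n j = ΣV^ (k ∸ toℕ j) v n

    ũ : Vector (suc k * D)
    ũ = blockVector topBlock

    block : Fin q → Fin (suc k) → Fin (suc k) → Matrix D D
    block r j j′ = coeff (k ∸ toℕ j) (toℕ r) (k ∸ toℕ j′)

    Ã : Fin q → Matrix (suc k * D) (suc k * D)
    Ã r = blockMatrix (block r)

    ũ-stack : ∀ n → ũ · stack k v n ≈ u · ΣV^ k v n
    ũ-stack n = begin
      ũ · stack k v n
        ≈⟨ ·-blockVector topBlock (stackBlock n) ⟩
      u · ΣV^ k v n + sumF k (λ j → (λ _ → 0#) · stackBlock n (suc j))
        ≈⟨ +-congˡ (sumF-zero k (λ j → ·-zeroˡ (stackBlock n (suc j)) (λ _ → refl))) ⟩
      u · ΣV^ k v n + 0#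
        ≈⟨ +-identityʳ _ ⟩
      u · ΣV^ k v n
        ∎

    Ã-stack : ∀ n r a → stack k v (q * n ℕ.+ toℕ r) a ≈ (Ã r ⊙ stack k v n) a
    Ã-stack n r a = begin
      stack k v (q * n ℕ.+ toℕ r) a
        ≡⟨⟩
      ΣV^ m v (q * n ℕ.+ toℕ r) i
        ≈⟨ ΣV^-expansion m (suc k) (s≤s (ℕₚ.m∸n≤m k (toℕ j))) n (toℕ r) (Finₚ.toℕ<n r) i ⟩
      Σ (λ t → (coeff m (toℕ r) t ⊙ ΣV^ t v n) i) (suc k)
        ≈⟨ Σ-reverse k _ ⟨
      sumF (suc k) (λ j′ → (coeff m (toℕ r) (k ∸ toℕ j′) ⊙ ΣV^ (k ∸ toℕ j′) v n) i)
        ≈⟨ ·-blockVector (λ j′ → block r j j′ i) (stackBlock n) ⟨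
      (Ã r ⊙ stack k v n) a
        ∎
      where
      j : Fin (suc k)
      j = quotient D a
      i : Fin D
      i = remainder {suc k} D a
      m : ℕ
      m = k ∸ toℕ j

    isLinRep : IsLinRep q (suc k * D) (Σ^ k x) ũ Ã (stack k v)
    isLinRep = (λ n → trans (Σ^-· u v (proj₁ rep) k n) (sym (ũ-stack n))) , Ã-stack

    Ã-blockUpperTri : ∀ r → BlockUpperTri k (Ã r) (diagBlock q k A r)
    Ã-blockUpperTri r = below , diagonal
      where
      below : ∀ j j′ i i′ → toℕ j′ < toℕ j → Ã r (combine j i) (combine j′ i′) ≈ 0#
      below j j′ i i′ j′<j = trans (reflexive (blockMatrix-combine (block r) j j′ i i′))
        (coeff-vanishes _ _ _ (ℕₚ.∸-monoʳ-< j′<j (Finₚ.toℕ≤pred[n] j)) i i′)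
      diagonal : ∀ j i i′ → Ã r (combine j i) (combine j i′) ≈ diagBlock q k A r j i i′
      diagonal j i i′ =
        trans (reflexive (blockMatrix-combine (block r) j j i i′)) (coeff-diagBlock k r j i i′)

lemma2p3 : ∀ {c ℓ} (R : CommutativeRing c ℓ) → let open Reg R in
    (q D : ℕ) → 2 ≤ q →
    (x : ℕ → CommutativeRing.Carrier R) (u : Vector D) (A : Fin q → Matrix D D)
    (v : ℕ → Vector D) → IsLinRep q D x u A v →
    (k : ℕ) → 1 ≤ k →
    Σ[ ũ ∈ Vector (suc k * D) ] Σ[ Ã ∈ (Fin q → Matrix (suc k * D) (suc k * D)) ]
      (IsLinRep q (suc k * D) (Σ^ k x) ũ Ã (stack k v) ×
       (∀ (r : Fin q) → BlockUpperTri k (Ã r) (diagBlock q k A r)))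
lemma2p3 R q D _ x u A v rep k _ = ũ , Ã , isLinRep , Ã-blockUpperTri
  where open RegularSummation.SummatoryRepresentation R x u A v rep k
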